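{- Let $s\ge 2$ and $n\ge 1$ be integers and let $P,Q\subset[s]$ be non-empty and disjoint. Let $\mathcal{F},\mathcal{G}\subset[s]^n$ be such that $\mathcal{F}$ is $P$-complete and $\mathcal{G}$ is $Q$-complete. Then $$|\mathcal{F}|\,|\mathcal{G}|\ge s^n\,|\mathcal{F}\cap\mathcal{G}|.$$
   Context: $[s]=\{1,\ldots,s\}$ and $[s]^n$ is the set of all sequences $(x_1,\ldots,x_n)$ with $x_i\in[s]$. For $P\subset[s]$, write $(x_1,\ldots,x_n)<_P(y_1,\ldots,y_n)$ if for every $1\le i\le n$ either $x_i=y_i$ or $x_i\notin P$. A family $\mathcal{F}\subset[s]^n$ is $P$-complete if whenever $\vec x\in\mathcal{F}$ and $\vec x<_P\vec y$, also $\vec y\in\mathcal{F}$. -}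

module Defs where

open import Data.Nat using (ℕ; zero; suc)
open import Data.Bool using (Bool; true; false; _∧_; T)
open import Data.Fin using (Fin)
open import Data.Fin.Subset using (Subset; _∈_; _∉_; Nonempty; Empty; _∩_)
open import Data.Vec using (Vec; []; _∷_; lookup)
open import Data.List using (List; []; _∷_; map; concatMap; allFin; length; filterᵇ)
open import Data.Sum using (_⊎_)
open import Relation.Binary.PropositionalEquality using (_≡_)

Seq : ℕ → ℕ → Set
Seq s n = Vec (Fin s) n

Family : ℕ → ℕ → Set
Family s n = Seq s n → Bool

allSeqs : (s n : ℕ) → List (Seq s n)
allSeqs s zero = [] ∷ []
allSeqs s (suc n) = concatMap (λ x → map (x ∷_) (allSeqs s n)) (allFin s)

card : {s n : ℕ} → Family s n → ℕ
card {s} {n} F = length (filterᵇ F (allSeqs s n))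

_∩F_ : {s n : ℕ} → Family s n → Family s n → Family s n
(F ∩F G) x = F x ∧ G x

_<[_]_ : {s n : ℕ} → Seq s n → Subset s → Seq s n → Set
x <[ P ] y = ∀ i → (lookup x i ≡ lookup y i) ⊎ (lookup x i ∉ P)

Complete : {s n : ℕ} → Subset s → Family s n → Set
Complete P F = ∀ x y → T (F x) → x <[ P ] y → T (F y)

Disjoint : {s : ℕ} → Subset s → Subset s → Set
Disjoint P Q = Empty (P ∩ Q)

{-# OPTIONS --safe #-}
-- Induction on n, splitting off the first coordinate.  Along a line
-- {a ∷ x ∣ a ∈ [s]} a P-complete family either contains the whole line or meets
-- it only in P × {x}.  As P ∩ Q = ∅, on each line F or G is full (equality) or
-- F ∩ G is empty, so s·|F ∩ G| ≤ |F|·|G| there.  Summing over the tails x gives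
-- s·Σₐ |Fₐ ∩ Gₐ| ≤ Σₐ Σ_b |Fₐ ∩ G_b| for the slices Fₐ = {x ∣ a ∷ x ∈ F}, which are
-- again P-complete, and by induction s^(n-1)·|Fₐ ∩ G_b| ≤ |Fₐ|·|G_b|.
module Submission where

open import Defs
open import Data.Nat using (ℕ; _*_; _^_; _≤_)
open import Data.Fin.Subset using (Subset; Nonempty)

open import Algebra.Properties.CommutativeSemigroup using (interchange; xy∙z≈y∙xz)
open import Data.Bool using (Bool; true; false; _∧_; T; T?)
open import Data.Bool.Properties using (∧-comm; T-≡)
open import Data.Empty using (⊥-elim)
open import Data.Fin using (Fin; zero; suc)
open import Data.Fin.Properties using (all?)
open import Data.Fin.Subset using (_∈_; _∉_)
open import Data.Fin.Subset.Properties using (_∈?_; x∈p∩q⁺)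
open import Data.List using (List; []; _∷_; _++_; map; concatMap; allFin; length; filterᵇ)
open import Data.List.Properties using (length-tabulate)
open import Data.Nat using (zero; suc; _+_; z≤n)
open import Data.Nat.Properties
open import Data.Product using (_,_)
open import Data.Sum using (_⊎_; inj₁; inj₂)
open import Data.Vec using ([]; _∷_)
open import Function.Bundles using (module Equivalence)
open import Relation.Binary.PropositionalEquality
open import Relation.Nullary.Decidable using (yes; no; decidable-stable)

private
  variable
    A B : Set
    s n : ℕ

∑ : List A → (A → ℕ) → ℕ
∑ []       f = 0
∑ (x ∷ xs) f = f x + ∑ xs f

infix 9 ∑
syntax ∑ xs (λ x → e) = ∑[ x ∈ xs ] e

∑-cong : (xs : List A) {f g : A → ℕ} → (∀ x → f x ≡ g x) → ∑ xs f ≡ ∑ xs g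
∑-cong []       f≡g = refl
∑-cong (x ∷ xs) f≡g = cong₂ _+_ (f≡g x) (∑-cong xs f≡g)

∑-mono-≤ : (xs : List A) {f g : A → ℕ} → (∀ x → f x ≤ g x) → ∑ xs f ≤ ∑ xs g
∑-mono-≤ []       f≤g = z≤n
∑-mono-≤ (x ∷ xs) f≤g = +-mono-≤ (f≤g x) (∑-mono-≤ xs f≤g)

∑-++ : (xs ys : List A) (f : A → ℕ) → ∑ (xs ++ ys) f ≡ ∑ xs f + ∑ ys f
∑-++ []       ys f = refl
∑-++ (x ∷ xs) ys f = trans (cong (f x +_) (∑-++ xs ys f)) (sym (+-assoc (f x) _ _))

∑-map : (h : A → B) (xs : List A) (f : B → ℕ) → ∑ (map h xs) f ≡ ∑[ x ∈ xs ] f (h x)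
∑-map h []       f = refl
∑-map h (x ∷ xs) f = cong (f (h x) +_) (∑-map h xs f)

∑-concatMap : (h : A → List B) (xs : List A) (f : B → ℕ) →
              ∑ (concatMap h xs) f ≡ ∑[ x ∈ xs ] ∑ (h x) f
∑-concatMap h []       f = refl
∑-concatMap h (x ∷ xs) f =
  trans (∑-++ (h x) (concatMap h xs) f) (cong (∑ (h x) f +_) (∑-concatMap h xs f))

∑-zero : (xs : List A) → ∑[ x ∈ xs ] 0 ≡ 0
∑-zero []       = refl
∑-zero (x ∷ xs) = ∑-zero xs

∑-one : (xs : List A) → ∑[ x ∈ xs ] 1 ≡ length xs
∑-one []       = refl
∑-one (x ∷ xs) = cong suc (∑-one xs)

∑-distrib-+ : (xs : List A) (f g : A → ℕ) → ∑[ x ∈ xs ] (f x + g x) ≡ ∑ xs f + ∑ xs g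
∑-distrib-+ []       f g = refl
∑-distrib-+ (x ∷ xs) f g = begin
  f x + g x + ∑[ y ∈ xs ] (f y + g y) ≡⟨ cong (f x + g x +_) (∑-distrib-+ xs f g) ⟩
  f x + g x + (∑ xs f + ∑ xs g)       ≡⟨ interchange +-commutativeSemigroup (f x) (g x) _ _ ⟩
  f x + ∑ xs f + (g x + ∑ xs g)       ∎
  where open ≡-Reasoning

*-distribˡ-∑ : (c : ℕ) (xs : List A) (f : A → ℕ) → c * ∑ xs f ≡ ∑[ x ∈ xs ] (c * f x)
*-distribˡ-∑ c []       f = *-zeroʳ c
*-distribˡ-∑ c (x ∷ xs) f =
  trans (*-distribˡ-+ c (f x) (∑ xs f)) (cong (c * f x +_) (*-distribˡ-∑ c xs f))

∑-comm : (xs : List A) (ys : List B) (f : A → B → ℕ) →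
         ∑[ x ∈ xs ] ∑[ y ∈ ys ] f x y ≡ ∑[ y ∈ ys ] ∑[ x ∈ xs ] f x y
∑-comm []       ys f = sym (∑-zero ys)
∑-comm (x ∷ xs) ys f = begin
  ∑ ys (f x) + ∑[ x′ ∈ xs ] ∑ ys (f x′)       ≡⟨ cong (∑ ys (f x) +_) (∑-comm xs ys f) ⟩
  ∑ ys (f x) + ∑[ y ∈ ys ] ∑[ x′ ∈ xs ] f x′ y ≡⟨ ∑-distrib-+ ys (f x) _ ⟨
  ∑[ y ∈ ys ] (f x y + ∑[ x′ ∈ xs ] f x′ y)    ∎
  where open ≡-Reasoning

∑*∑ : (xs : List A) (ys : List B) (f : A → ℕ) (g : B → ℕ) →
      ∑ xs f * ∑ ys g ≡ ∑[ x ∈ xs ] ∑[ y ∈ ys ] (f x * g y)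
∑*∑ []       ys f g = refl
∑*∑ (x ∷ xs) ys f g = begin
  (f x + ∑ xs f) * ∑ ys g                          ≡⟨ *-distribʳ-+ (∑ ys g) (f x) (∑ xs f) ⟩
  f x * ∑ ys g + ∑ xs f * ∑ ys g                   ≡⟨ cong₂ _+_ (*-distribˡ-∑ (f x) ys g) (∑*∑ xs ys f g) ⟩
  ∑[ y ∈ ys ] (f x * g y) + ∑[ x′ ∈ xs ] ∑[ y ∈ ys ] (f x′ * g y) ∎
  where open ≡-Reasoning

𝟙 : Bool → ℕ
𝟙 true  = 1
𝟙 false = 0

𝟙-∧ : ∀ a b → 𝟙 (a ∧ b) ≡ 𝟙 a * 𝟙 b
𝟙-∧ true  b = sym (+-identityʳ (𝟙 b))
𝟙-∧ false b = refl

length-filterᵇ : (p : A → Bool) (xs : List A) → length (filterᵇ p xs) ≡ ∑[ x ∈ xs ] 𝟙 (p x)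
length-filterᵇ p []       = refl
length-filterᵇ p (x ∷ xs) with p x
... | true  = cong suc (length-filterᵇ p xs)
... | false = length-filterᵇ p xs

count : Family s n → ℕ
count {s} {n} F = ∑[ x ∈ allSeqs s n ] 𝟙 (F x)

card≡count : (F : Family s n) → card F ≡ count F
card≡count {s} {n} F = length-filterᵇ F (allSeqs s n)

LineComplete : Subset s → (Fin s → Bool) → Set
LineComplete R α = ∀ a c → a ∉ R → T (α a) → T (α c)

LineComplete-dichotomy : (R : Subset s) (α : Fin s → Bool) → LineComplete R α →
                         (∀ c → T (α c)) ⊎ (∀ a → T (α a) → a ∈ R)
LineComplete-dichotomy R α complete with all? (λ c → T? (α c))
... | yes full = inj₁ full
... | no ¬full = inj₂ λ a αa →
  decidable-stable (a ∈? R) (λ a∉R → ¬full (λ c → complete a c a∉R αa))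

∑-∧-full : (α β : A → Bool) → (∀ a → T (α a)) → (xs : List A) →
           ∑[ a ∈ xs ] 𝟙 (α a ∧ β a) ≡ ∑[ a ∈ xs ] 𝟙 (β a)
∑-∧-full α β full xs =
  ∑-cong xs (λ a → cong (λ b → 𝟙 (b ∧ β a)) (Equivalence.to T-≡ (full a)))

module _ {s : ℕ} where

  ∑-full : (α : Fin s → Bool) → (∀ a → T (α a)) → ∑[ a ∈ allFin s ] 𝟙 (α a) ≡ s
  ∑-full α full = begin
    ∑[ a ∈ allFin s ] 𝟙 (α a) ≡⟨ ∑-cong (allFin s) (λ a → cong 𝟙 (Equivalence.to T-≡ (full a))) ⟩
    ∑[ a ∈ allFin s ] 1       ≡⟨ ∑-one (allFin s) ⟩
    length (allFin s)         ≡⟨ length-tabulate {n = s} (λ a → a) ⟩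
    s                         ∎
    where open ≡-Reasoning

  ∑-∧-disjoint : {P Q : Subset s} → Disjoint P Q → (α β : Fin s → Bool) →
                 (∀ a → T (α a) → a ∈ P) → (∀ a → T (β a) → a ∈ Q) →
                 (xs : List (Fin s)) → ∑[ a ∈ xs ] 𝟙 (α a ∧ β a) ≡ 0
  ∑-∧-disjoint disjoint α β α⊆P β⊆Q xs = trans (∑-cong xs empty) (∑-zero xs)
    where
    empty : ∀ a → 𝟙 (α a ∧ β a) ≡ 0
    empty a with α a in αa | β a in βa
    ... | false | _     = refl
    ... | true  | false = refl
    ... | true  | true  =
      ⊥-elim (disjoint (a , x∈p∩q⁺ (α⊆P a (Equivalence.from T-≡ αa) ,
                                     β⊆Q a (Equivalence.from T-≡ βa))))

  line-correlation : {P Q : Subset s} → Disjoint P Q → (α β : Fin s → Bool) →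
                     LineComplete P α → LineComplete Q β →
                     s * ∑[ a ∈ allFin s ] 𝟙 (α a ∧ β a)
                       ≤ ∑[ a ∈ allFin s ] 𝟙 (α a) * ∑[ b ∈ allFin s ] 𝟙 (β b)
  line-correlation {P} {Q} disjoint α β αP βQ
    with LineComplete-dichotomy P α αP | LineComplete-dichotomy Q β βQ
  ... | inj₁ α-full | _ = ≤-reflexive (begin
    s * ∑[ a ∈ L ] 𝟙 (α a ∧ β a)            ≡⟨ cong (s *_) (∑-∧-full α β α-full L) ⟩
    s * ∑[ b ∈ L ] 𝟙 (β b)                  ≡⟨ cong (_* ∑[ b ∈ L ] 𝟙 (β b)) (∑-full α α-full) ⟨
    ∑[ a ∈ L ] 𝟙 (α a) * ∑[ b ∈ L ] 𝟙 (β b) ∎)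
    where
    open ≡-Reasoning
    L : List (Fin s)
    L = allFin s
  ... | inj₂ _ | inj₁ β-full = ≤-reflexive (begin
    s * ∑[ a ∈ L ] 𝟙 (α a ∧ β a)            ≡⟨ cong (s *_) (∑-cong L (λ a → cong 𝟙 (∧-comm (α a) (β a)))) ⟩
    s * ∑[ a ∈ L ] 𝟙 (β a ∧ α a)            ≡⟨ cong (s *_) (∑-∧-full β α β-full L) ⟩
    s * ∑[ a ∈ L ] 𝟙 (α a)                  ≡⟨ *-comm s _ ⟩
    ∑[ a ∈ L ] 𝟙 (α a) * s                  ≡⟨ cong (∑[ a ∈ L ] 𝟙 (α a) *_) (∑-full β β-full) ⟨
    ∑[ a ∈ L ] 𝟙 (α a) * ∑[ b ∈ L ] 𝟙 (β b) ∎)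
    where
    open ≡-Reasoning
    L : List (Fin s)
    L = allFin s
  ... | inj₂ α⊆P | inj₂ β⊆Q
    rewrite ∑-∧-disjoint disjoint α β α⊆P β⊆Q (allFin s) | *-zeroʳ s = z≤n

slice : Family s (suc n) → Fin s → Family s n
slice F a x = F (a ∷ x)

line : Family s (suc n) → Seq s n → Fin s → Bool
line F x a = F (a ∷ x)

count-slices : (F : Family s (suc n)) → count F ≡ ∑[ a ∈ allFin s ] count (slice F a)
count-slices {s} {n} F =
  trans (∑-concatMap (λ a → map (a ∷_) (allSeqs s n)) (allFin s) (λ x → 𝟙 (F x)))
        (∑-cong (allFin s) (λ a → ∑-map (a ∷_) (allSeqs s n) (λ x → 𝟙 (F x))))

Complete-slice : (R : Subset s) (F : Family s (suc n)) → Complete R F →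
                 ∀ a → Complete R (slice F a)
Complete-slice R F complete a x y Fax x<y = complete (a ∷ x) (a ∷ y) Fax a∷x<a∷y
  where
  a∷x<a∷y : (a ∷ x) <[ R ] (a ∷ y)
  a∷x<a∷y zero    = inj₁ refl
  a∷x<a∷y (suc i) = x<y i

Complete-line : (R : Subset s) (F : Family s (suc n)) → Complete R F →
                ∀ x → LineComplete R (line F x)
Complete-line R F complete x a c a∉R Fax = complete (a ∷ x) (c ∷ x) Fax a∷x<c∷x
  where
  a∷x<c∷x : (a ∷ x) <[ R ] (c ∷ x)
  a∷x<c∷x zero    = inj₂ a∉R
  a∷x<c∷x (suc i) = inj₁ refl

slices-correlation : {P Q : Subset s} → Disjoint P Q → (F G : Family s (suc n)) →
                     Complete P F → Complete Q G →
                     s * ∑[ a ∈ allFin s ] count (slice F a ∩F slice G a)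
                       ≤ ∑[ a ∈ allFin s ] ∑[ b ∈ allFin s ] count (slice F a ∩F slice G b)
slices-correlation {s} {n} {P} {Q} disjoint F G PF QG = begin
  s * ∑[ a ∈ L ] ∑[ x ∈ X ] 𝟙 (F (a ∷ x) ∧ G (a ∷ x))
    ≡⟨ cong (s *_) (∑-comm L X _) ⟩
  s * ∑[ x ∈ X ] ∑[ a ∈ L ] 𝟙 (F (a ∷ x) ∧ G (a ∷ x))
    ≡⟨ *-distribˡ-∑ s X _ ⟩
  ∑[ x ∈ X ] (s * ∑[ a ∈ L ] 𝟙 (F (a ∷ x) ∧ G (a ∷ x)))
    ≤⟨ ∑-mono-≤ X (λ x → line-correlation disjoint (line F x) (line G x)
                            (Complete-line P F PF x) (Complete-line Q G QG x)) ⟩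
  ∑[ x ∈ X ] (∑[ a ∈ L ] 𝟙 (F (a ∷ x)) * ∑[ b ∈ L ] 𝟙 (G (b ∷ x)))
    ≡⟨ ∑-cong X (λ x → ∑*∑ L L _ _) ⟩
  ∑[ x ∈ X ] ∑[ a ∈ L ] ∑[ b ∈ L ] (𝟙 (F (a ∷ x)) * 𝟙 (G (b ∷ x)))
    ≡⟨ ∑-cong X (λ x → ∑-cong L (λ a → ∑-cong L (λ b → 𝟙-∧ (F (a ∷ x)) (G (b ∷ x))))) ⟨
  ∑[ x ∈ X ] ∑[ a ∈ L ] ∑[ b ∈ L ] 𝟙 (F (a ∷ x) ∧ G (b ∷ x))
    ≡⟨ ∑-comm X L _ ⟩
  ∑[ a ∈ L ] ∑[ x ∈ X ] ∑[ b ∈ L ] 𝟙 (F (a ∷ x) ∧ G (b ∷ x))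
    ≡⟨ ∑-cong L (λ a → ∑-comm X L _) ⟩
  ∑[ a ∈ L ] ∑[ b ∈ L ] ∑[ x ∈ X ] 𝟙 (F (a ∷ x) ∧ G (b ∷ x)) ∎
  where
  open ≤-Reasoning
  L : List (Fin s)
  L = allFin s
  X : List (Seq s n)
  X = allSeqs s n

negative-correlation : {P Q : Subset s} → Disjoint P Q → (n : ℕ) (F G : Family s n) →
                       Complete P F → Complete Q G →
                       s ^ n * count (F ∩F G) ≤ count F * count G
negative-correlation disjoint zero F G _ _ with F [] | G []
... | true  | true  = ≤-refl
... | true  | false = z≤n
... | false | _     = z≤n
negative-correlation {s} {P} {Q} disjoint (suc n) F G PF QG = begin
  s ^ suc n * count (F ∩F G)
    ≡⟨ cong (s ^ suc n *_) (count-slices (F ∩F G)) ⟩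
  s * s ^ n * ∑[ a ∈ L ] count (slice F a ∩F slice G a)
    ≡⟨ xy∙z≈y∙xz *-commutativeSemigroup s (s ^ n) _ ⟩
  s ^ n * (s * ∑[ a ∈ L ] count (slice F a ∩F slice G a))
    ≤⟨ *-monoʳ-≤ (s ^ n) (slices-correlation disjoint F G PF QG) ⟩
  s ^ n * ∑[ a ∈ L ] ∑[ b ∈ L ] count (slice F a ∩F slice G b)
    ≡⟨ trans (*-distribˡ-∑ (s ^ n) L _) (∑-cong L (λ a → *-distribˡ-∑ (s ^ n) L _)) ⟩
  ∑[ a ∈ L ] ∑[ b ∈ L ] (s ^ n * count (slice F a ∩F slice G b))
    ≤⟨ ∑-mono-≤ L (λ a → ∑-mono-≤ L (λ b →
         negative-correlation disjoint n (slice F a) (slice G b)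
           (Complete-slice P F PF a) (Complete-slice Q G QG b))) ⟩
  ∑[ a ∈ L ] ∑[ b ∈ L ] (count (slice F a) * count (slice G b))
    ≡⟨ ∑*∑ L L _ _ ⟨
  ∑[ a ∈ L ] count (slice F a) * ∑[ b ∈ L ] count (slice G b)
    ≡⟨ cong₂ _*_ (count-slices F) (count-slices G) ⟨
  count F * count G ∎
  where
  open ≤-Reasoning
  L : List (Fin s)
  L = allFin s

theorem5 : (s n : ℕ) → 2 ≤ s → 1 ≤ n →
    (P Q : Subset s) → Nonempty P → Nonempty Q → Disjoint P Q →
    (F G : Family s n) → Complete P F → Complete Q G →
    s ^ n * card (F ∩F G) ≤ card F * card G
theorem5 s n _ _ P Q _ _ disjoint F G PF QG
  rewrite card≡count (F ∩F G) | card≡count F | card≡count G =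
  negative-correlation disjoint n F G PF QG
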